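{- For every positive integer $i$, letting $n_i = 2^{i+1}-i$, we have $$\operatorname{mp}(Q_{n_i})\geqslant \frac{n_i}{2} + \frac{\log_2 n_i - 1}{2}.$$
   Context: $Q_m$ is the $m$-dimensional hypercube: vertex set $\{0,1\}^m$, two vertices adjacent iff they differ in exactly one coordinate. For a vertex $v$ and integer $k\geqslant 0$, $N_k[v]$ is the set of vertices at graph distance at most $k$ from $v$. A set $M$ of vertices is a multipacking if $|N_k[v]\cap M|\leqslant k$ for every vertex $v$ and every integer $k\geqslant 1$; $\operatorname{mp}(G)$ is the maximum size of a multipacking in $G$. -}

module Defs where

open import Data.Nat using (ℕ; zero; suc; _+_; _*_; _∸_; _^_; _≤_)
open import Data.Bool using (Bool)
open import Data.Fin using (Fin)
open import Data.Vec using (Vec; lookup)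
open import Data.List using (List; length)
open import Data.List.Relation.Unary.All using (All)
open import Data.List.Relation.Unary.Unique.Propositional using (Unique)
open import Data.List.Membership.Propositional using (_∈_)
open import Data.Product using (Σ; _×_; ∃)
open import Relation.Binary.PropositionalEquality using (_≡_; _≢_)

Vertex : ℕ → Set
Vertex m = Vec Bool m

Adj : {m : ℕ} → Vertex m → Vertex m → Set
Adj {m} u v = Σ (Fin m) λ j →
  (lookup u j ≢ lookup v j) × ((l : Fin m) → l ≢ j → lookup u l ≡ lookup v l)

-- Within k u v : the graph distance from u to v in Q_m is at most k,
-- i.e. there is a walk from u to v of length at most k.
data Within {m : ℕ} : ℕ → Vertex m → Vertex m → Set where
  here : ∀ {k u} → Within k u u
  step : ∀ {k u w v} → Adj u w → Within k w v → Within (suc k) u v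

InBall : {m : ℕ} → ℕ → Vertex m → Vertex m → Set
InBall k v u = Within k v u

-- |N_k[v] ∩ M| ≤ k, where M is given as a duplicate-free list:
-- every duplicate-free list of elements of N_k[v] ∩ M has length at most k.
BallBound : {m : ℕ} → List (Vertex m) → ℕ → Vertex m → Set
BallBound {m} M k v =
  (L : List (Vertex m)) → Unique L →
  All (λ u → (u ∈ M) × InBall k v u) L → length L ≤ k

IsMultipacking : (m : ℕ) → List (Vertex m) → Set
IsMultipacking m M =
  Unique M × ((v : Vertex m) (k : ℕ) → 1 ≤ k → BallBound M k v)

MpAtLeast : ℕ → ℕ → Set
MpAtLeast m s = ∃ λ (M : List (Vertex m)) → IsMultipacking m M × length M ≡ s

{-# OPTIONS --safe #-}
module Submission where

-- Start from the antipodal pair {000, 111} of Q₃: a multipacking of size 2 with no two points at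
-- distance 2. If M is a multipacking of Qₙ of size s with no two points at distance s, and
-- n + c + 1 = 2s, then {x x 0ᶜ, x x̄ 1ᶜ | x ∈ M} is such a multipacking of Q_{2n+c} of size 2s:
-- distances inside a copy double and distances across the copies are n + c = 2s - 1, while a ball
-- about (a, b, e) meets the copies in the two ellipses d(a,x) + d(b,x) + d(e,0ᶜ) ≤ k and
-- d(a,x) + d(b̄,x) + d(e,1ᶜ) ≤ k of Qₙ, which together hold at most k points of M.
-- Doubling j times with c = j gives size 2ʲ⁺¹ in dimension 2ʲ⁺² - (j + 1).

open import Defs
open import Data.Bool using (Bool; true; false; not; _xor_)
open import Data.Bool.Properties using (xor-comm; xor-same; not-involutive; not-distribˡ-xor; not-distribʳ-xor)
import Data.Bool as Bool
open import Data.Fin using (zero; suc)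
import Data.Fin.Properties as Fin
open import Data.List using (List; []; _∷_; length; filter)
import Data.List as List
open import Data.List.Properties using (length-++; length-map; filter-++; filter-none; filter-accept; filter-some)
open import Data.List.Membership.Propositional using (_∈_; find)
open import Data.List.Membership.Propositional.Properties using (∈-∃++; ∈-++⁻; ∈-++⁺ˡ; ∈-++⁺ʳ; ∈-map⁻; ∈-filter⁺)
open import Data.List.Relation.Binary.Subset.Propositional using (_⊆_)
open import Data.List.Relation.Unary.All using (All)
import Data.List.Relation.Unary.All as All
open import Data.List.Relation.Unary.All.Properties using (¬Any⇒All¬)
open import Data.List.Relation.Unary.AllPairs using ([]; _∷_)
open import Data.List.Relation.Unary.Any using (Any; here; there; any?; satisfied)
open import Data.List.Relation.Unary.Unique.Propositional using (Unique)
open import Data.Nat using (ℕ; zero; suc; pred; _+_; _*_; _^_; _∸_; _≤_; _<_; z≤n; s≤s; >-nonZero)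
open import Data.Nat.Properties
open import Algebra.Properties.CommutativeSemigroup +-commutativeSemigroup using (interchange)
open import Data.Nat.Tactic.RingSolver using (solve-∀)
open import Data.Product using (∃; ∃-syntax; _×_; _,_; proj₂)
open import Data.Sum using (_⊎_; inj₁; inj₂; [_,_])
open import Data.Vec using (Vec; []; _∷_; _++_; map; replicate; lookup; splitAt)
open import Data.Vec.Properties using (≡-dec; map-replicate; tabulate∘lookup; tabulate-cong)
open import Function using (_∘_)
open import Function.Metric.Nat.Definitions using (Symmetric; TriangleInequality)
open import Level using (0ℓ)
open import Relation.Binary.Definitions using (DecidableEquality)
open import Relation.Binary.PropositionalEquality using (_≡_; _≢_; refl; sym; trans; cong; cong₂; subst; module ≡-Reasoning)
open import Relation.Nullary using (yes; no; does; ¬_; contradiction)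
open import Relation.Unary using (Pred; Decidable; ∁)
open import Relation.Unary.Properties using (_∪?_; _∩?_)

private
  variable
    A B : Set
    m n : ℕ

count : {P : Pred A 0ℓ} → Decidable P → List A → ℕ
count P? xs = length (filter P? xs)

module _ {P : Pred A 0ℓ} (P? : Decidable P) where

  count-++ : ∀ xs ys → count P? (xs List.++ ys) ≡ count P? xs + count P? ys
  count-++ xs ys = trans (cong length (filter-++ P? xs ys)) (length-++ (filter P? xs))

  count-map : (f : B → A) (xs : List B) → count P? (List.map f xs) ≡ count (P? ∘ f) xs
  count-map f [] = refl
  count-map f (x ∷ xs) with does (P? (f x))
  ... | true  = cong suc (count-map f xs)
  ... | false = count-map f xs

  count≤length : ∀ xs → count P? xs ≤ length xs
  count≤length [] = z≤n
  count≤length (x ∷ xs) with does (P? x)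
  ... | true  = s≤s (count≤length xs)
  ... | false = m≤n⇒m≤1+n (count≤length xs)

  count≤count-∷ : ∀ x xs → count P? xs ≤ count P? (x ∷ xs)
  count≤count-∷ x xs with does (P? x)
  ... | true  = n≤1+n _
  ... | false = ≤-refl

  count-pair≤1 : ∀ {x y} → ¬ (P x × P y) → count P? (x ∷ y ∷ []) ≤ 1
  count-pair≤1 {x} {y} ¬both with P? x
  ... | no _  = count≤length (y ∷ [])
  ... | yes px with P? y
  ...   | yes py = contradiction (px , py) ¬both
  ...   | no _   = ≤-refl

  count-none : ∀ {xs} → All (∁ P) xs → count P? xs ≡ 0
  count-none ¬ps = cong length (filter-none P? ¬ps)

  count-mono : {Q : Pred A 0ℓ} (Q? : Decidable Q) → ∀ xs → (∀ {x} → x ∈ xs → P x → Q x) →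
               count P? xs ≤ count Q? xs
  count-mono Q? [] P⇒Q = z≤n
  count-mono Q? (x ∷ xs) P⇒Q with P? x | Q? x
  ... | yes _  | yes _  = s≤s (count-mono Q? xs (P⇒Q ∘ there))
  ... | no _   | yes _  = m≤n⇒m≤1+n (count-mono Q? xs (P⇒Q ∘ there))
  ... | no _   | no _   = count-mono Q? xs (P⇒Q ∘ there)
  ... | yes px | no ¬qx = contradiction (P⇒Q (here refl) px) ¬qx

  count-∪+count-∩ : {Q : Pred A 0ℓ} (Q? : Decidable Q) → ∀ xs →
                    count P? xs + count Q? xs ≡ count (P? ∪? Q?) xs + count (P? ∩? Q?) xs
  count-∪+count-∩ Q? [] = refl
  count-∪+count-∩ Q? (x ∷ xs) with P? x | Q? x | count-∪+count-∩ Q? xs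
  ... | yes _ | yes _ | ih = cong suc (trans (+-suc _ _) (trans (cong suc ih) (sym (+-suc _ _))))
  ... | yes _ | no _  | ih = cong suc ih
  ... | no _  | yes _ | ih = trans (+-suc _ _) (cong suc ih)
  ... | no _  | no _  | ih = ih

  count-∪≤ : {Q : Pred A 0ℓ} (Q? : Decidable Q) → ∀ xs → count (P? ∪? Q?) xs ≤ count P? xs + count Q? xs
  count-∪≤ Q? xs = ≤-trans (m≤m+n _ _) (≤-reflexive (sym (count-∪+count-∩ Q? xs)))

Unique-⊆⇒length≤ : {xs ys : List A} → Unique xs → xs ⊆ ys → length xs ≤ length ys
Unique-⊆⇒length≤ {xs = []} _ _ = z≤n
Unique-⊆⇒length≤ {xs = x ∷ xs} (x∉xs ∷ unique) xs⊆ys with ∈-∃++ (xs⊆ys (here refl))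
... | ys₁ , ys₂ , refl = begin
  suc (length xs)                 ≤⟨ s≤s (Unique-⊆⇒length≤ unique (skip x∉xs)) ⟩
  suc (length (ys₁ List.++ ys₂))  ≡⟨ cong suc (length-++ ys₁) ⟩
  suc (length ys₁ + length ys₂)   ≡⟨ +-suc (length ys₁) _ ⟨
  length ys₁ + length (x ∷ ys₂)   ≡⟨ length-++ ys₁ ⟨
  length (ys₁ List.++ x ∷ ys₂)    ∎
  where
  open ≤-Reasoning
  skip : All (x ≢_) xs → xs ⊆ ys₁ List.++ ys₂
  skip x≢xs y∈xs with ∈-++⁻ ys₁ (xs⊆ys (there y∈xs))
  ... | inj₁ y∈ys₁         = ∈-++⁺ˡ y∈ys₁
  ... | inj₂ (here refl)   = contradiction refl (All.lookup x≢xs y∈xs)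
  ... | inj₂ (there y∈ys₂) = ∈-++⁺ʳ ys₁ y∈ys₂

count≤1⇒Unique : (_≟_ : DecidableEquality A) → {xs : List A} →
                 (∀ x → count (x ≟_) xs ≤ 1) → Unique xs
count≤1⇒Unique _≟_ {[]} _ = []
count≤1⇒Unique _≟_ {x ∷ xs} atMostOnce =
  All.tabulate (λ y∈xs x≡y → x∉xs (subst (_∈ xs) (sym x≡y) y∈xs)) ∷
  count≤1⇒Unique _≟_ (λ y → ≤-trans (count≤count-∷ (y ≟_) x xs) (atMostOnce y))
  where
  x∉xs : ¬ x ∈ xs
  x∉xs x∈xs = 1+n≰n (begin
    2                             ≤⟨ s≤s (filter-some (x ≟_) x∈xs) ⟩
    suc (count (x ≟_) xs)         ≡⟨ cong length (filter-accept (x ≟_) refl) ⟨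
    count (x ≟_) (x ∷ xs)         ≤⟨ atMostOnce x ⟩
    1                             ∎)
    where open ≤-Reasoning

2*m≤1+2*n⇒m≤n : ∀ {m n} → 2 * m ≤ suc (2 * n) → m ≤ n
2*m≤1+2*n⇒m≤n {m} {n} 2m≤1+2n = ≮⇒≥ λ n<m → 1+n≰n (begin
  suc (suc (2 * n)) ≡⟨ *-suc 2 n ⟨
  2 * suc n         ≤⟨ *-monoʳ-≤ 2 n<m ⟩
  2 * m             ≤⟨ 2m≤1+2n ⟩
  suc (2 * n)       ∎)
  where open ≤-Reasoning

module MultipackingCount {V : Set} (d : V → V → ℕ)
                         (d-sym : Symmetric d) (d-triangle : TriangleInequality d) where

  ball? : (v : V) (r : ℕ) → Decidable (λ x → d v x ≤ r)
  ball? v r x = d v x ≤? r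

  Multipacking : List V → Set
  Multipacking M = ∀ v r → 1 ≤ r → count (ball? v r) M ≤ r

  AvoidsDistance : ℕ → List V → Set
  AvoidsDistance s M = ∀ {x y} → x ∈ M → y ∈ M → d x y ≢ s

  d≤0⇒same-distances : ∀ {a z₀} → d a z₀ ≤ 0 → ∀ z → d a z ≡ d z₀ z
  d≤0⇒same-distances {a} {z₀} d≤0 z = ≤-antisym
    (≤-trans (d-triangle a z₀ z) (+-monoˡ-≤ (d z₀ z) d≤0))
    (≤-trans (d-triangle z₀ a z) (≤-reflexive (cong (_+ d a z) (trans (d-sym z₀ a) (n≤0⇒n≡0 d≤0)))))

  ellipse? : (a b : V) (K : ℕ) → Decidable (λ x → d a x + d b x ≤ K)
  ellipse? a b K x = d a x + d b x ≤? K

  ellipse-count≤ : ∀ {M} → Multipacking M → ∀ a b {K} → 1 ≤ K → count (ellipse? a b K) M ≤ K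
  ellipse-count≤ {M} mp a b {suc zero} _ =
    ≤-trans (count-mono (ellipse? a b 1) (ball? a 1) M (λ _ → ≤-trans (m≤m+n _ _))) (mp a 1 ≤-refl)
  ellipse-count≤ {M} mp a b {suc (suc r)} _ = begin
    count (ellipse? a b (2 + r)) M                     ≤⟨ count-mono (ellipse? a b (2 + r)) (ball? a 1 ∪? ball? b (suc r)) M
                                                                     (λ _ → near-a-or-b) ⟩
    count (ball? a 1 ∪? ball? b (suc r)) M             ≤⟨ count-∪≤ (ball? a 1) (ball? b (suc r)) M ⟩
    count (ball? a 1) M + count (ball? b (suc r)) M    ≤⟨ +-mono-≤ (mp a 1 ≤-refl) (mp b (suc r) (s≤s z≤n)) ⟩
    2 + r                                              ∎
    where
    open ≤-Reasoning
    near-a-or-b : ∀ {x} → d a x + d b x ≤ 2 + r → d a x ≤ 1 ⊎ d b x ≤ suc r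
    near-a-or-b {x} in-ellipse with d a x ≤? 1
    ... | yes near-a = inj₁ near-a
    ... | no far-a   = inj₂ (m≤n⇒m≤1+n (+-cancelˡ-≤ 2 _ _ (≤-trans (+-monoˡ-≤ (d b x) (≰⇒> far-a)) in-ellipse)))

  d-via : ∀ b x a → d b a ≤ d a x + d b x
  d-via b x a = ≤-trans (d-triangle b x a) (≤-reflexive (trans (cong (d b x +_) (d-sym x a)) (+-comm (d b x) (d a x))))

  -- E₁ and E₂ are the distances from a centre of the doubled cube to the two copies of x. If both
  -- ellipses meet M then s ≤ k, and a common point lies within k - s of a, so inclusion–exclusion
  -- gives s + (k - s). When s = k a common point is at distance 0 from a, and if M has such a point
  -- the avoided distance s confines the union to the ball of radius s - 1 about a.
  module TwoEllipses {M : List V} {s n c : ℕ} (mp : Multipacking M) (|M|≡s : length M ≡ s)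
                     (avoids : AvoidsDistance s M) (2≤s : 2 ≤ s) (1+n+c≡2s : suc (n + c) ≡ 2 * s)
                     {b b′ : V} (antipodal : ∀ x → d b x + d b′ x ≡ n)
                     {w w′ : ℕ} (w+w′≡c : w + w′ ≡ c) (a : V) {k : ℕ} (1≤k : 1 ≤ k) where

    E₁ E₂ : V → ℕ
    E₁ x = d a x + (d b x + w)
    E₂ x = d a x + (d b′ x + w′)

    E₁? : Decidable (λ x → E₁ x ≤ k)
    E₁? x = E₁ x ≤? k

    E₂? : Decidable (λ x → E₂ x ≤ k)
    E₂? x = E₂ x ≤? k

    private
      open ≤-Reasoning

      n+c≤E₁+E₂ : ∀ x y → n + c ≤ E₁ x + E₂ y
      n+c≤E₁+E₂ x y = begin
        n + c                                       ≡⟨ cong₂ _+_ (antipodal a) w+w′≡c ⟨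
        (d b a + d b′ a) + (w + w′)                 ≡⟨ interchange (d b a) (d b′ a) w w′ ⟩
        (d b a + w) + (d b′ a + w′)                 ≤⟨ +-mono-≤ (+-monoˡ-≤ w (d-via b x a)) (+-monoˡ-≤ w′ (d-via b′ y a)) ⟩
        (d a x + d b x + w) + (d a y + d b′ y + w′) ≡⟨ cong₂ _+_ (+-assoc (d a x) _ w) (+-assoc (d a y) _ w′) ⟩
        E₁ x + E₂ y                                 ∎

      E₁+E₂≡ : ∀ z → E₁ z + E₂ z ≡ 2 * d a z + (n + c)
      E₁+E₂≡ z = trans (rearrange (d a z) (d b z) w (d b′ z) w′) (cong (2 * d a z +_) (cong₂ _+_ (antipodal z) w+w′≡c))
        where
        rearrange : ∀ p q u q′ u′ → (p + (q + u)) + (p + (q′ + u′)) ≡ 2 * p + ((q + q′) + (u + u′))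
        rearrange = solve-∀

      E₁+E₂≤2k : ∀ {x y} → E₁ x ≤ k → E₂ y ≤ k → E₁ x + E₂ y ≤ 2 * k
      E₁+E₂≤2k p q = ≤-trans (+-mono-≤ p q) (≤-reflexive (cong (k +_) (sym (+-identityʳ k))))

      both-hit⇒s≤k : ∀ {x y} → E₁ x ≤ k → E₂ y ≤ k → s ≤ k
      both-hit⇒s≤k {x} {y} p q = 2*m≤1+2*n⇒m≤n (begin
        2 * s          ≡⟨ 1+n+c≡2s ⟨
        suc (n + c)    ≤⟨ s≤s (≤-trans (n+c≤E₁+E₂ x y) (E₁+E₂≤2k p q)) ⟩
        suc (2 * k)    ∎)

      both⇒d≤k∸s : ∀ {z} → E₁ z ≤ k × E₂ z ≤ k → d a z ≤ k ∸ s
      both⇒d≤k∸s {z} (p , q) = m+n≤o⇒m≤o∸n (d a z) (2*m≤1+2*n⇒m≤n (begin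
        2 * (d a z + s)            ≡⟨ *-distribˡ-+ 2 (d a z) s ⟩
        2 * d a z + 2 * s          ≡⟨ cong (2 * d a z +_) 1+n+c≡2s ⟨
        2 * d a z + suc (n + c)    ≡⟨ +-suc _ _ ⟩
        suc (2 * d a z + (n + c))  ≡⟨ cong suc (E₁+E₂≡ z) ⟨
        suc (E₁ z + E₂ z)          ≤⟨ s≤s (E₁+E₂≤2k p q) ⟩
        suc (2 * k)                ∎))

      either⇒d≤k : ∀ {z} → E₁ z ≤ k ⊎ E₂ z ≤ k → d a z ≤ k
      either⇒d≤k = [ ≤-trans (m≤m+n _ _) , ≤-trans (m≤m+n _ _) ]

      count-E₁≤k : count E₁? M ≤ k
      count-E₁≤k = ≤-trans (count-mono E₁? (ellipse? a b k) M (λ _ → ≤-trans (+-monoʳ-≤ (d a _) (m≤m+n _ w))))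
                           (ellipse-count≤ {M} mp a b 1≤k)

      count-E₂≤k : count E₂? M ≤ k
      count-E₂≤k = ≤-trans (count-mono E₂? (ellipse? a b′ k) M (λ _ → ≤-trans (+-monoʳ-≤ (d a _) (m≤m+n _ w′))))
                           (ellipse-count≤ {M} mp a b′ 1≤k)

      apart : k < s → count E₁? M + count E₂? M ≤ k
      apart k<s with any? E₁? M
      ... | no miss₁ = begin
        count E₁? M + count E₂? M  ≡⟨ cong (_+ count E₂? M) (count-none E₁? (¬Any⇒All¬ M miss₁)) ⟩
        count E₂? M                ≤⟨ count-E₂≤k ⟩
        k                          ∎
      ... | yes hit₁ = begin
        count E₁? M + count E₂? M  ≡⟨ cong (count E₁? M +_) (count-none E₂? (¬Any⇒All¬ M miss₂)) ⟩
        count E₁? M + 0            ≡⟨ +-identityʳ _ ⟩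
        count E₁? M                ≤⟨ count-E₁≤k ⟩
        k                          ∎
        where
        miss₂ : ¬ Any (λ y → E₂ y ≤ k) M
        miss₂ hit₂ = <⇒≱ k<s (both-hit⇒s≤k (proj₂ (satisfied hit₁)) (proj₂ (satisfied hit₂)))

      overlapping : s < k → count (E₁? ∪? E₂?) M + count (E₁? ∩? E₂?) M ≤ k
      overlapping s<k = begin
        count (E₁? ∪? E₂?) M + count (E₁? ∩? E₂?) M  ≤⟨ +-mono-≤ (count≤length (E₁? ∪? E₂?) M) both≤k∸s ⟩
        length M + (k ∸ s)                           ≡⟨ cong (_+ (k ∸ s)) |M|≡s ⟩
        s + (k ∸ s)                                  ≡⟨ m+[n∸m]≡n (<⇒≤ s<k) ⟩
        k                                            ∎
        where
        both≤k∸s : count (E₁? ∩? E₂?) M ≤ k ∸ s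
        both≤k∸s = ≤-trans (count-mono (E₁? ∩? E₂?) (ball? a (k ∸ s)) M (λ _ → both⇒d≤k∸s))
                           (mp a (k ∸ s) (m<n⇒0<n∸m s<k))

      both⇒d≤0 : s ≡ k → ∀ {z} → E₁ z ≤ k × E₂ z ≤ k → d a z ≤ 0
      both⇒d≤0 s≡k both = ≤-trans (both⇒d≤k∸s both) (≤-reflexive (trans (cong (k ∸_) s≡k) (n∸n≡0 k)))

      tight : s ≡ k → count (E₁? ∪? E₂?) M + count (E₁? ∩? E₂?) M ≤ k
      tight s≡k with any? (ball? a 0) M
      ... | no a∉M = begin
        count (E₁? ∪? E₂?) M + count (E₁? ∩? E₂?) M  ≤⟨ +-mono-≤ (count≤length (E₁? ∪? E₂?) M) both≤0 ⟩
        length M + 0                                 ≡⟨ trans (+-identityʳ _) |M|≡s ⟩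
        s                                            ≡⟨ s≡k ⟩
        k                                            ∎
        where
        both≤0 : count (E₁? ∩? E₂?) M ≤ 0
        both≤0 = ≤-trans (count-mono (E₁? ∩? E₂?) (ball? a 0) M (λ _ → both⇒d≤0 s≡k))
                         (≤-reflexive (count-none (ball? a 0) (¬Any⇒All¬ M a∉M)))
      ... | yes a∈M with find a∈M
      ...   | z₀ , z₀∈M , d[a,z₀]≤0 = begin
        count (E₁? ∪? E₂?) M + count (E₁? ∩? E₂?) M  ≤⟨ +-mono-≤ either≤pred-s both≤1 ⟩
        pred s + 1                                   ≡⟨ +-comm (pred s) 1 ⟩
        suc (pred s)                                 ≡⟨ suc-pred s {{>-nonZero (≤-trans (s≤s z≤n) 2≤s)}} ⟩
        s                                            ≡⟨ s≡k ⟩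
        k                                            ∎
        where
        off-centre : ∀ {z} → z ∈ M → E₁ z ≤ k ⊎ E₂ z ≤ k → d a z ≤ pred s
        off-centre {z} z∈M either = <⇒≤pred (≤∧≢⇒< (≤-trans (either⇒d≤k either) (≤-reflexive (sym s≡k)))
                                                     (avoids z₀∈M z∈M ∘ trans (sym (d≤0⇒same-distances d[a,z₀]≤0 z))))
        either≤pred-s : count (E₁? ∪? E₂?) M ≤ pred s
        either≤pred-s = ≤-trans (count-mono (E₁? ∪? E₂?) (ball? a (pred s)) M off-centre)
                                (mp a (pred s) (pred-mono-≤ 2≤s))
        both≤1 : count (E₁? ∩? E₂?) M ≤ 1
        both≤1 = ≤-trans (count-mono (E₁? ∩? E₂?) (ball? a 1) M (λ _ → m≤n⇒m≤1+n ∘ both⇒d≤0 s≡k))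
                         (mp a 1 ≤-refl)

    count-E₁+count-E₂≤k : count E₁? M + count E₂? M ≤ k
    count-E₁+count-E₂≤k with s ≤? k
    ... | no s≰k = apart (≰⇒> s≰k)
    ... | yes s≤k = begin
      count E₁? M + count E₂? M                     ≡⟨ count-∪+count-∩ E₁? E₂? M ⟩
      count (E₁? ∪? E₂?) M + count (E₁? ∩? E₂?) M  ≤⟨ [ overlapping , tight ] (m≤n⇒m<n∨m≡n s≤k) ⟩
      k                                             ∎

bit : Bool → ℕ
bit false = 0
bit true  = 1

hamming : Vec Bool n → Vec Bool n → ℕ
hamming []       []       = 0
hamming (x ∷ xs) (y ∷ ys) = bit (x xor y) + hamming xs ys

hamming-sym : Symmetric (hamming {n})
hamming-sym []       []       = refl
hamming-sym (x ∷ xs) (y ∷ ys) = cong₂ _+_ (cong bit (xor-comm x y)) (hamming-sym xs ys)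

bit-xor-triangle : ∀ x y z → bit (x xor z) ≤ bit (x xor y) + bit (y xor z)
bit-xor-triangle false false z     = ≤-refl
bit-xor-triangle true  true  z     = ≤-refl
bit-xor-triangle false true  false = z≤n
bit-xor-triangle false true  true  = s≤s z≤n
bit-xor-triangle true  false false = s≤s z≤n
bit-xor-triangle true  false true  = z≤n

hamming-triangle : TriangleInequality (hamming {n})
hamming-triangle []       []       []       = z≤n
hamming-triangle (x ∷ xs) (y ∷ ys) (z ∷ zs) = begin
  bit (x xor z) + hamming xs zs                                   ≤⟨ +-mono-≤ (bit-xor-triangle x y z) (hamming-triangle xs ys zs) ⟩
  (bit (x xor y) + bit (y xor z)) + (hamming xs ys + hamming ys zs) ≡⟨ interchange (bit (x xor y)) _ _ _ ⟩
  (bit (x xor y) + hamming xs ys) + (bit (y xor z) + hamming ys zs) ∎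
  where open ≤-Reasoning

hamming-self : ∀ (xs : Vec Bool n) → hamming xs xs ≡ 0
hamming-self []       = refl
hamming-self (x ∷ xs) = cong₂ _+_ (cong bit (xor-same x)) (hamming-self xs)

hamming-++ : ∀ (xs ys : Vec Bool m) (us vs : Vec Bool n) →
             hamming (xs ++ us) (ys ++ vs) ≡ hamming xs ys + hamming us vs
hamming-++ []       []       us vs = refl
hamming-++ (x ∷ xs) (y ∷ ys) us vs =
  trans (cong (bit (x xor y) +_) (hamming-++ xs ys us vs)) (sym (+-assoc (bit (x xor y)) (hamming xs ys) (hamming us vs)))

bit+bit-not : ∀ b → bit b + bit (not b) ≡ 1
bit+bit-not false = refl
bit+bit-not true  = refl

hamming-complement : ∀ (xs ys : Vec Bool n) → hamming xs ys + hamming xs (map not ys) ≡ n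
hamming-complement []       []       = refl
hamming-complement {suc n} (x ∷ xs) (y ∷ ys) = begin
  (bit (x xor y) + hamming xs ys) + (bit (x xor not y) + hamming xs (map not ys)) ≡⟨ interchange (bit (x xor y)) _ _ _ ⟩
  (bit (x xor y) + bit (x xor not y)) + (hamming xs ys + hamming xs (map not ys)) ≡⟨ cong₂ _+_ bit-complement (hamming-complement xs ys) ⟩
  1 + n                                                                           ∎
  where
  open ≡-Reasoning
  bit-complement : bit (x xor y) + bit (x xor not y) ≡ 1
  bit-complement = trans (cong ((bit (x xor y) +_) ∘ bit) (sym (not-distribʳ-xor x y))) (bit+bit-not (x xor y))

hamming-map-not : ∀ (xs ys : Vec Bool n) → hamming (map not xs) (map not ys) ≡ hamming xs ys
hamming-map-not []       []       = refl
hamming-map-not (x ∷ xs) (y ∷ ys) = cong₂ _+_ (cong bit (not-xor-not x y)) (hamming-map-not xs ys)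
  where
  not-xor-not : ∀ x y → not x xor not y ≡ x xor y
  not-xor-not false y = not-involutive y
  not-xor-not true  y = refl

hamming-map-notʳ : ∀ (xs ys : Vec Bool n) → hamming xs (map not ys) ≡ hamming (map not xs) ys
hamming-map-notʳ []       []       = refl
hamming-map-notʳ (x ∷ xs) (y ∷ ys) =
  cong₂ _+_ (cong bit (trans (sym (not-distribʳ-xor x y)) (not-distribˡ-xor x y))) (hamming-map-notʳ xs ys)

zeros ones : Vec Bool n
zeros = replicate _ false
ones  = replicate _ true

hamming-zeros-ones : hamming (zeros {n}) ones ≡ n
hamming-zeros-ones {zero}  = refl
hamming-zeros-ones {suc n} = cong suc (hamming-zeros-ones {n})

hamming-zeros+hamming-ones : ∀ (xs : Vec Bool n) → hamming xs zeros + hamming xs ones ≡ n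
hamming-zeros+hamming-ones {n} xs =
  trans (cong ((hamming xs zeros +_) ∘ hamming xs) (sym (map-replicate not false n))) (hamming-complement xs zeros)

agree-away-from⇒hamming≤1 : ∀ (xs ys : Vec Bool n) j →
                           (∀ l → l ≢ j → lookup xs l ≡ lookup ys l) → hamming xs ys ≤ 1
agree-away-from⇒hamming≤1 (x ∷ xs) (y ∷ ys) zero agree = begin
  bit (x xor y) + hamming xs ys ≡⟨ cong (bit (x xor y) +_) (trans (cong (hamming xs) (sym tails-equal)) (hamming-self xs)) ⟩
  bit (x xor y) + 0             ≤⟨ +-monoˡ-≤ 0 (bit≤1 (x xor y)) ⟩
  1                             ∎
  where
  open ≤-Reasoning
  tails-equal : xs ≡ ys
  tails-equal = trans (sym (tabulate∘lookup xs)) (trans (tabulate-cong (λ l → agree (suc l) λ ())) (tabulate∘lookup ys))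
  bit≤1 : ∀ b → bit b ≤ 1
  bit≤1 false = z≤n
  bit≤1 true  = ≤-refl
agree-away-from⇒hamming≤1 (x ∷ xs) (y ∷ ys) (suc j) agree = begin
  bit (x xor y) + hamming xs ys ≡⟨ cong (λ z → bit (x xor z) + hamming xs ys) (sym (agree zero λ ())) ⟩
  bit (x xor x) + hamming xs ys ≡⟨ cong (λ b → bit b + hamming xs ys) (xor-same x) ⟩
  hamming xs ys                 ≤⟨ agree-away-from⇒hamming≤1 xs ys j (λ l l≢j → agree (suc l) (l≢j ∘ Fin.suc-injective)) ⟩
  1                             ∎
  where open ≤-Reasoning

Adj⇒hamming≤1 : {u v : Vertex m} → Adj u v → hamming u v ≤ 1
Adj⇒hamming≤1 {u = u} {v} (j , _ , agree) = agree-away-from⇒hamming≤1 u v j agree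

Within⇒hamming≤ : ∀ {k} {u v : Vertex m} → Within k u v → hamming u v ≤ k
Within⇒hamming≤ {u = u} here = ≤-trans (≤-reflexive (hamming-self u)) z≤n
Within⇒hamming≤ {u = u} {v} (step {w = w} u~w w⇝v) =
  ≤-trans (hamming-triangle u w v) (+-mono-≤ (Adj⇒hamming≤1 {u = u} {w} u~w) (Within⇒hamming≤ w⇝v))

module HypercubeMultipacking {m : ℕ} = MultipackingCount (hamming {m}) hamming-sym hamming-triangle
open HypercubeMultipacking

Multipacking⇒IsMultipacking : ∀ {m} {M : List (Vertex m)} → Multipacking M → IsMultipacking m M
Multipacking⇒IsMultipacking {m} {M} mp = count≤1⇒Unique _≟ᵛ_ at-most-once , ball-bound
  where
  _≟ᵛ_ : DecidableEquality (Vertex m)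
  _≟ᵛ_ = ≡-dec Bool._≟_
  at-most-once : ∀ x → count (x ≟ᵛ_) M ≤ 1
  at-most-once x = ≤-trans (count-mono (x ≟ᵛ_) (ball? x 1) M λ { _ refl → ≤-trans (≤-reflexive (hamming-self x)) z≤n })
                           (mp x 1 ≤-refl)
  ball-bound : ∀ v k → 1 ≤ k → BallBound M k v
  ball-bound v k 1≤k L unique inBall = ≤-trans (Unique-⊆⇒length≤ unique in-filter) (mp v k 1≤k)
    where
    in-filter : ∀ {u} → u ∈ L → u ∈ filter (ball? v k) M
    in-filter u∈L with All.lookup inBall u∈L
    ... | u∈M , v⇝u = ∈-filter⁺ (ball? v k) u∈M (Within⇒hamming≤ v⇝u)

module _ {n c : ℕ} where

  embed₀ embed₁ : Vertex n → Vertex (n + (n + c))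
  embed₀ x = x ++ (x ++ zeros)
  embed₁ x = x ++ (map not x ++ ones)

  double : List (Vertex n) → List (Vertex (n + (n + c)))
  double M = List.map embed₀ M List.++ List.map embed₁ M

  hamming-embed₀ : ∀ a b e x → hamming (a ++ (b ++ e)) (embed₀ x) ≡ hamming a x + (hamming b x + hamming e zeros)
  hamming-embed₀ a b e x = trans (hamming-++ a x _ _) (cong (hamming a x +_) (hamming-++ b x e zeros))

  hamming-embed₁ : ∀ a b e x → hamming (a ++ (b ++ e)) (embed₁ x) ≡ hamming a x + (hamming (map not b) x + hamming e ones)
  hamming-embed₁ a b e x = trans (hamming-++ a x _ _)
    (cong (hamming a x +_) (trans (hamming-++ b (map not x) e ones) (cong (_+ hamming e ones) (hamming-map-notʳ b x))))

  hamming-embed₀-embed₀ : ∀ x y → hamming (embed₀ x) (embed₀ y) ≡ 2 * hamming x y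
  hamming-embed₀-embed₀ x y =
    trans (hamming-embed₀ x x zeros y) (cong (λ t → hamming x y + (hamming x y + t)) (hamming-self (zeros {c})))

  hamming-embed₁-embed₁ : ∀ x y → hamming (embed₁ x) (embed₁ y) ≡ 2 * hamming x y
  hamming-embed₁-embed₁ x y = trans (hamming-++ x y _ _) (cong (hamming x y +_) (trans
    (hamming-++ (map not x) (map not y) ones ones) (cong₂ _+_ (hamming-map-not x y) (hamming-self (ones {c})))))

  hamming-embed₀-embed₁ : ∀ x y → hamming (embed₀ x) (embed₁ y) ≡ n + c
  hamming-embed₀-embed₁ x y = begin
    hamming (embed₀ x) (embed₁ y)                                   ≡⟨ hamming-++ x y _ _ ⟩
    hamming x y + hamming (x ++ zeros) (map not y ++ ones)          ≡⟨ cong (hamming x y +_) (hamming-++ x (map not y) zeros ones) ⟩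
    hamming x y + (hamming x (map not y) + hamming (zeros {c}) ones) ≡⟨ +-assoc (hamming x y) _ _ ⟨
    (hamming x y + hamming x (map not y)) + hamming (zeros {c}) ones ≡⟨ cong₂ _+_ (hamming-complement x y) (hamming-zeros-ones {c}) ⟩
    n + c                                                           ∎
    where open ≡-Reasoning

  ∈-double⁻ : ∀ {M u} → u ∈ double M → ∃[ x ] x ∈ M × (u ≡ embed₀ x ⊎ u ≡ embed₁ x)
  ∈-double⁻ {M} u∈ with ∈-++⁻ (List.map embed₀ M) u∈
  ... | inj₁ u∈₀ = let x , x∈M , u≡ = ∈-map⁻ embed₀ u∈₀ in x , x∈M , inj₁ u≡
  ... | inj₂ u∈₁ = let x , x∈M , u≡ = ∈-map⁻ embed₁ u∈₁ in x , x∈M , inj₂ u≡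

  length-double : ∀ M → length (double M) ≡ 2 * length M
  length-double M = begin
    length (double M)                                        ≡⟨ length-++ (List.map embed₀ M) ⟩
    length (List.map embed₀ M) + length (List.map embed₁ M)  ≡⟨ cong₂ _+_ (length-map embed₀ M) (length-map embed₁ M) ⟩
    length M + length M                                      ≡⟨ cong (length M +_) (+-identityʳ _) ⟨
    2 * length M                                             ∎
    where open ≡-Reasoning

  module _ {s : ℕ} (1+n+c≡2s : suc (n + c) ≡ 2 * s) where

    n+c≢2s : n + c ≢ 2 * s
    n+c≢2s eq = 1+n≢n (trans 1+n+c≡2s (sym eq))

    double-avoids : ∀ {M} → AvoidsDistance s M → AvoidsDistance (2 * s) (double M)
    double-avoids avoids u∈ v∈ with ∈-double⁻ u∈ | ∈-double⁻ v∈
    ... | x , x∈ , inj₁ refl | y , y∈ , inj₁ refl = avoids x∈ y∈ ∘ *-cancelˡ-≡ _ _ 2 ∘ trans (sym (hamming-embed₀-embed₀ x y))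
    ... | x , x∈ , inj₂ refl | y , y∈ , inj₂ refl = avoids x∈ y∈ ∘ *-cancelˡ-≡ _ _ 2 ∘ trans (sym (hamming-embed₁-embed₁ x y))
    ... | x , _  , inj₁ refl | y , _  , inj₂ refl = n+c≢2s ∘ trans (sym (hamming-embed₀-embed₁ x y))
    ... | x , _  , inj₂ refl | y , _  , inj₁ refl = n+c≢2s ∘ trans (trans (sym (hamming-embed₀-embed₁ y x)) (hamming-sym (embed₀ y) (embed₁ x)))

    double-multipacking : ∀ {M} → Multipacking M → length M ≡ s → AvoidsDistance s M → 2 ≤ s →
                          Multipacking (double M)
    double-multipacking {M} mp |M|≡s avoids 2≤s v k 1≤k with splitAt n v
    ... | a , be , refl with splitAt n be
    ... | b , e , refl = begin
      count (ball? v k) (double M)                                                   ≡⟨ count-++ (ball? v k) (List.map embed₀ M) _ ⟩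
      count (ball? v k) (List.map embed₀ M) + count (ball? v k) (List.map embed₁ M)  ≡⟨ cong₂ _+_ (count-map (ball? v k) embed₀ M)
                                                                                                    (count-map (ball? v k) embed₁ M) ⟩
      count (ball? v k ∘ embed₀) M + count (ball? v k ∘ embed₁) M                    ≤⟨ +-mono-≤ copy₀≤E₁ copy₁≤E₂ ⟩
      count E₁? M + count E₂? M                                                      ≤⟨ count-E₁+count-E₂≤k ⟩
      k                                                                              ∎
      where
      open ≤-Reasoning
      antipodal : ∀ x → hamming b x + hamming (map not b) x ≡ n
      antipodal x = trans (cong₂ _+_ (hamming-sym b x) (hamming-sym (map not b) x)) (hamming-complement x b)
      open TwoEllipses mp |M|≡s avoids 2≤s 1+n+c≡2s {b} {map not b} antipodal
                       {hamming e zeros} {hamming e ones} (hamming-zeros+hamming-ones e) a 1≤k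
      copy₀≤E₁ : count (ball? v k ∘ embed₀) M ≤ count E₁? M
      copy₀≤E₁ = count-mono (ball? v k ∘ embed₀) E₁? M (λ _ → subst (_≤ k) (hamming-embed₀ a b e _))
      copy₁≤E₂ : count (ball? v k ∘ embed₁) M ≤ count E₂? M
      copy₁≤E₂ = count-mono (ball? v k ∘ embed₁) E₂? M (λ _ → subst (_≤ k) (hamming-embed₁ a b e _))

record Doublable (m s : ℕ) : Set where
  field
    points       : List (Vertex m)
    size         : length points ≡ s
    multipacking : Multipacking points
    avoids       : AvoidsDistance s points

double-Doublable : ∀ {n c s} → suc (n + c) ≡ 2 * s → 2 ≤ s → Doublable n s → Doublable (n + (n + c)) (2 * s)
double-Doublable 1+n+c≡2s 2≤s D = record
  { points       = double points
  ; size         = trans (length-double points) (cong (2 *_) size)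
  ; multipacking = double-multipacking 1+n+c≡2s multipacking size avoids 2≤s
  ; avoids       = double-avoids 1+n+c≡2s avoids
  }
  where open Doublable D

antipodes : List (Vertex 3)
antipodes = zeros ∷ ones ∷ []

antipodes-Doublable : Doublable 3 2
antipodes-Doublable = record
  { points       = antipodes
  ; size         = refl
  ; multipacking = antipodes-multipacking
  ; avoids       = antipodes-avoids
  }
  where
  antipodes-multipacking : Multipacking antipodes
  antipodes-multipacking v zero ()
  antipodes-multipacking v (suc zero) _ = count-pair≤1 (ball? v 1) λ (near₀ , near₁) →
    1+n≰n (subst (_≤ 2) (hamming-zeros+hamming-ones v) (+-mono-≤ near₀ near₁))
  antipodes-multipacking v (suc (suc k)) _ = ≤-trans (count≤length (ball? v (2 + k)) antipodes) (s≤s (s≤s z≤n))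
  antipodes-avoids : AvoidsDistance 2 antipodes
  antipodes-avoids (here refl)         (here refl)         ()
  antipodes-avoids (here refl)         (there (here refl)) ()
  antipodes-avoids (there (here refl)) (here refl)         ()
  antipodes-avoids (there (here refl)) (there (here refl)) ()

dim : ℕ → ℕ
dim zero    = 3
dim (suc j) = dim j + (dim j + j)

1+dim+j≡2^[2+j] : ∀ j → suc (dim j + j) ≡ 2 ^ suc (suc j)
1+dim+j≡2^[2+j] zero    = refl
1+dim+j≡2^[2+j] (suc j) = trans (rearrange (dim j) j) (cong (2 *_) (1+dim+j≡2^[2+j] j))
  where
  rearrange : ∀ d j → suc (d + (d + j) + suc j) ≡ 2 * suc (d + j)
  rearrange = solve-∀

dim-Doublable : ∀ j → Doublable (dim j) (2 ^ suc j)
dim-Doublable zero    = antipodes-Doublable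
dim-Doublable (suc j) = double-Doublable (1+dim+j≡2^[2+j] j) (*-monoʳ-≤ 2 (m^n>0 2 j)) (dim-Doublable j)

dim≤2^[2+j] : ∀ j → dim j ≤ 2 ^ suc (suc j)
dim≤2^[2+j] j = ≤-trans (m≤n⇒m≤1+n (m≤m+n (dim j) j)) (≤-reflexive (1+dim+j≡2^[2+j] j))

2^[2+j]∸[1+j]≡dim : ∀ j → 2 ^ suc (suc j) ∸ suc j ≡ dim j
2^[2+j]∸[1+j]≡dim j = begin
  2 ^ suc (suc j) ∸ suc j  ≡⟨ cong (_∸ suc j) (1+dim+j≡2^[2+j] j) ⟨
  suc (dim j + j) ∸ suc j  ≡⟨ cong (_∸ suc j) (+-suc (dim j) j) ⟨
  dim j + suc j ∸ suc j    ≡⟨ m+n∸n≡m (dim j) (suc j) ⟩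
  dim j                    ∎
  where open ≡-Reasoning

2^[2+j]+1∸dim≡2+j : ∀ j → (2 ^ suc (suc j) + 1) ∸ dim j ≡ suc (suc j)
2^[2+j]+1∸dim≡2+j j = begin
  (2 ^ suc (suc j) + 1) ∸ dim j  ≡⟨ cong (λ t → (t + 1) ∸ dim j) (1+dim+j≡2^[2+j] j) ⟨
  (suc (dim j + j) + 1) ∸ dim j  ≡⟨ cong (_∸ dim j) (rearrange (dim j) j) ⟩
  (dim j + suc (suc j)) ∸ dim j  ≡⟨ m+n∸m≡n (dim j) (suc (suc j)) ⟩
  suc (suc j)                    ∎
  where
  open ≡-Reasoning
  rearrange : ∀ d j → suc (d + j) + 1 ≡ d + suc (suc j)
  rearrange = solve-∀

proposition2 : (i : ℕ) → 1 ≤ i →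
    ∃ λ (s : ℕ) → MpAtLeast (2 ^ (suc i) ∸ i) s
    × ((2 ^ (suc i) ∸ i) ≤ 2 * s + 1)
    × ((2 ^ (suc i) ∸ i) ≤ 2 ^ ((2 * s + 1) ∸ (2 ^ (suc i) ∸ i)))
proposition2 zero ()
proposition2 (suc j) _ rewrite 2^[2+j]∸[1+j]≡dim j =
  2 ^ suc j ,
  (points , Multipacking⇒IsMultipacking multipacking , size) ,
  ≤-trans (dim≤2^[2+j] j) (m≤m+n _ 1) ,
  subst (λ e → dim j ≤ 2 ^ e) (sym (2^[2+j]+1∸dim≡2+j j)) (dim≤2^[2+j] j)
  where open Doublable (dim-Doublable j)
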